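{- Let $(\Sigma,<)$ be a finite totally ordered alphabet and $w\in\Sigma^+$. If $(m_1,\ldots,m_k)$ is a grouping of $\mathrm{CFL}_{in}(w)$, then $\mathrm{CFL}_{in}(m_i)=\mathcal{NB}(m_i)$ for each $i$, $1\le i\le k$.
   Context: Lexicographic order $\prec$ on $\Sigma^*$: $x\prec y$ if $x$ is a proper prefix of $y$, or $x=ras$, $y=rbt$ with $a,b\in\Sigma$, $a<b$. For nonempty $x,y$, $x\ll y$ means $x\prec y$ and $x$ not a proper prefix of $y$; $x\ge_p y$ means $y$ is a prefix of $x$. An inverse Lyndon word is a $u\in\Sigma^+$ with $s\prec u$ for each nonempty proper suffix $s$ of $u$. Inverse order $<_{in}$: $b<_{in}a\iff a<b$; $\prec_{in}$ the induced lexicographic order. An anti-Lyndon word is a nonempty primitive word strictly smaller for $\prec_{in}$ than all its other conjugates. $\mathrm{CFL}_{in}(w)$ is the unique sequence $(\ell_1,\ldots,\ell_h)$ of anti-Lyndon words with $w=\ell_1\cdots\ell_h$ and $\ell_1\succeq_{in}\cdots\succeq_{in}\ell_h$. A PMC in $\mathrm{CFL}_{in}(w)$ is a block $\ell_r,\ldots,\ell_t$ of consecutive factors ($r\le t$) with $\ell_r\ge_p\cdots\ge_p\ell_t$, such that $\ell_r$ is not a prefix of $\ell_{r-1}$ if $r>1$ and $\ell_{t+1}$ is not a prefix of $\ell_t$ if $t<h$. A grouping of a sequence $(\lambda_1,\ldots,\lambda_n)$ of anti-Lyndon words with $\lambda_i$ a prefix of $\lambda_{i-1}$ is a sequence $(m_1,\ldots,m_q)$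 of inverse Lyndon words with $m_j=\lambda_{i_{j-1}+1}\cdots\lambda_{i_j}$ for indices $0=i_0<\cdots<i_q=n$ and $m_1\ll\cdots\ll m_q$. A grouping of $\mathrm{CFL}_{in}(w)$ is obtained by replacing each PMC of $\mathrm{CFL}_{in}(w)$ by a grouping of it. Borders: a border of a nonempty word $x$ is a proper prefix of $x$ that is also a suffix; bordered/unbordered according to whether a nonempty border exists; every bordered word has exactly one nonempty unbordered border. $\mathcal{NB}(x)=(x)$ if $x$ is unbordered; otherwise $\mathcal{NB}(x)=(\mathcal{NB}(y),z)$ where $z$ is the unique nonempty unbordered border of $x$ and $x=yz$. -}

module Defs where

open import Data.Nat using (ℕ)
open import Data.Fin using (Fin)
import Data.Fin as F
open import Data.List using (List; []; _∷_; _++_; concat; map; replicate)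
open import Data.List.Relation.Unary.All using (All)
open import Data.List.Relation.Unary.Linked using (Linked)
open import Data.List.Relation.Binary.Pointwise using (Pointwise)
open import Data.Product using (Σ; ∃; _×_; _,_)
open import Data.Sum using (_⊎_)
open import Relation.Binary.PropositionalEquality using (_≡_; _≢_)
open import Relation.Nullary using (¬_)
open import Data.Nat using (_≤_)

-- The finite totally ordered alphabet Σ is Fin n with its usual order.
Word : ℕ → Set
Word n = List (Fin n)

module _ {n : ℕ} where

  Nonempty : Word n → Set
  Nonempty x = x ≢ []

  Prefix : Word n → Word n → Set
  Prefix x y = Σ (Word n) λ s → y ≡ x ++ s

  ProperPrefix : Word n → Word n → Set
  ProperPrefix x y = Σ (Word n) λ s → Nonempty s × y ≡ x ++ s

  Lex : (Fin n → Fin n → Set) → Word n → Word n → Set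
  Lex R x y =
    ProperPrefix x y ⊎
    Σ (Word n) λ r → Σ (Fin n) λ a → Σ (Fin n) λ b → Σ (Word n) λ s → Σ (Word n) λ t →
      x ≡ r ++ (a ∷ s) × y ≡ r ++ (b ∷ t) × R a b

  _<ₗ_ : Fin n → Fin n → Set
  a <ₗ b = a F.< b

  _<ᵢₙ_ : Fin n → Fin n → Set
  a <ᵢₙ b = b F.< a

  _≺_ : Word n → Word n → Set
  _≺_ = Lex _<ₗ_

  _≺ᵢₙ_ : Word n → Word n → Set
  _≺ᵢₙ_ = Lex _<ᵢₙ_

  _≼ᵢₙ_ : Word n → Word n → Set
  x ≼ᵢₙ y = x ≺ᵢₙ y ⊎ x ≡ y

  _≪_ : Word n → Word n → Set
  x ≪ y = Nonempty x × Nonempty y × x ≺ y × ¬ ProperPrefix x y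

  _≥ₚ_ : Word n → Word n → Set
  x ≥ₚ y = Prefix y x

  InverseLyndon : Word n → Set
  InverseLyndon u = Nonempty u ×
    ((p s : Word n) → Nonempty p → Nonempty s → u ≡ p ++ s → s ≺ u)

  power : Word n → ℕ → Word n
  power y k = concat (replicate k y)

  Primitive : Word n → Set
  Primitive x = (y : Word n) (k : ℕ) → 2 ≤ k → x ≢ power y k

  AntiLyndon : Word n → Set
  AntiLyndon x = Nonempty x × Primitive x ×
    ((u v : Word n) → x ≡ u ++ v → v ++ u ≢ x → x ≺ᵢₙ (v ++ u))

  IsCFLin : Word n → List (Word n) → Set
  IsCFLin w L = All AntiLyndon L × concat L ≡ w × Linked (λ a b → b ≼ᵢₙ a) L

  Border : Word n → Word n → Set
  Border z x = ProperPrefix z x × Σ (Word n) λ q → x ≡ q ++ z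

  Bordered : Word n → Set
  Bordered x = Σ (Word n) λ z → Nonempty z × Border z x

  Unbordered : Word n → Set
  Unbordered x = Nonempty x × ¬ Bordered x

  -- NB(x) as a (functional) relation: IsNB x K means NB(x) = K
  data IsNB : Word n → List (Word n) → Set where
    nb-unb  : ∀ {x} → Unbordered x → IsNB x (x ∷ [])
    nb-step : ∀ {x y z K} → Nonempty z → Border z x → Unbordered z →
              x ≡ y ++ z → IsNB y K → IsNB x (K ++ (z ∷ []))

  IsGroupingOf : List (Word n) → List (Word n) → Set
  IsGroupingOf λs ms = Σ (List (List (Word n))) λ blocks →
    All (λ b → b ≢ []) blocks × concat blocks ≡ λs × ms ≡ map concat blocks ×
    All InverseLyndon ms × Linked _≪_ ms

  -- PMC decomposition of a sequence L: L is cut into consecutive nonempty blocks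
  -- ℓ_r ≥_p ⋯ ≥_p ℓ_t, maximal: the first factor of each block is not a prefix
  -- of the last factor of the preceding block.  These blocks are exactly the PMCs.
  Boundary : List (Word n) → List (Word n) → Set
  Boundary P Q = (P' : List (Word n)) (a b : Word n) (Q' : List (Word n)) →
    P ≡ P' ++ (a ∷ []) → Q ≡ b ∷ Q' → ¬ Prefix b a

  PrefixChain : List (Word n) → Set
  PrefixChain B = B ≢ [] × Linked _≥ₚ_ B

  IsPMCDecomposition : List (Word n) → List (List (Word n)) → Set
  IsPMCDecomposition L pmcs =
    concat pmcs ≡ L × All PrefixChain pmcs × Linked Boundary pmcs

  IsGroupingOfCFL : List (Word n) → List (Word n) → Set
  IsGroupingOfCFL L ms = Σ (List (List (Word n))) λ pmcs →
    IsPMCDecomposition L pmcs ×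
    Σ (List (List (Word n))) λ gs → Pointwise IsGroupingOf pmcs gs × ms ≡ concat gs

{-# OPTIONS --safe #-}
-- The factors of CFL_in(w) inside one PMC form a chain ℓ_r ≥ₚ ⋯ ≥ₚ ℓ_t, so every
-- m_i of a grouping is a product λ₁ ⋯ λₖ of anti-Lyndon words, each a prefix of the
-- previous one.  Such a product is its own CFL_in, since a prefix is ≼_in-below the
-- word.  Anti-Lyndon words are unbordered (a border z, x = zu = vz, would force
-- u ≺_in v from the conjugate zv and v ≼_in u from the conjugate uz, unless
-- u = v and x = zu = uz is a proper power), so each λⱼ (j > 1), being a prefix of
-- λ₁, is an unbordered border of λ₁ ⋯ λⱼ; hence NB(m_i) = (λ₁, …, λₖ) as well.
module Submission where

open import Defs
open import Data.Nat using (ℕ)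
open import Data.List using (List)
open import Data.List.Membership.Propositional using (_∈_)
open import Data.Product using (Σ; _×_)

open import Level using (Level)
open import Data.Nat using (zero; suc; _+_; _<_; _≤_; s≤s; z≤n)
open import Data.Nat.Properties using (≤-total; m≤n+m; +-mono-≤; +-cancelˡ-≡; suc-injective)
open import Data.Fin using (Fin)
import Data.Fin.Properties as Fin
open import Data.List using ([]; _∷_; _++_; [_]; concat; length)
open import Data.List.Properties
  using (++-assoc; ++-identityʳ; ++-cancelˡ; ++-cancelʳ; ++-conicalʳ; ∷-injective; length-++; length-++-comm; ≡-dec)
open import Data.List.Membership.Propositional.Properties using (∈-concat⁻′; ∈-map⁻)
open import Data.List.Relation.Unary.Any using (here; there)
open import Data.List.Relation.Unary.All as All using (All; []; _∷_)
open import Data.List.Relation.Unary.AllPairs using (AllPairs; []; _∷_)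
open import Data.List.Relation.Unary.Linked as Linked using (Linked)
open import Data.List.Relation.Unary.Linked.Properties using (AllPairs⇒Linked; Linked⇒AllPairs)
open import Data.List.Relation.Binary.Pointwise using (Pointwise; []; _∷_)
open import Data.List.Relation.Binary.Sublist.Propositional using (_⊆_; []; _∷_; _∷ʳ_; ⊆-refl; ⊆-trans)
open import Data.List.Relation.Binary.Sublist.Propositional.Properties using (All-resp-⊆; ++⁺ˡ; ++⁺ʳ)
open import Data.List.Relation.Binary.Lex.Strict using (Lex-<; halt; this; next; <-asymmetric)
open import Data.Product as Product using (_,_; proj₂)
open import Data.Sum as Sum using (inj₁; inj₂; _⊎_)
open import Data.Empty using (⊥-elim)
open import Function using (_∘_)
open import Data.Nat.Induction using (<-wellFounded)
open import Induction.WellFounded using (Acc; acc)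
open import Relation.Binary using (Rel; Asymmetric)
open import Relation.Nullary using (¬_; yes; no)
open import Relation.Binary.PropositionalEquality
  using (_≡_; _≢_; refl; sym; trans; cong; cong₂; subst; subst₂; resp₂; module ≡-Reasoning)

private
  variable
    a ℓ : Level
    A : Set a

AllPairs-resp-⊆ : {R : Rel A ℓ} {xs ys : List A} → xs ⊆ ys → AllPairs R ys → AllPairs R xs
AllPairs-resp-⊆ []         []       = []
AllPairs-resp-⊆ (_ ∷ʳ τ)   (_ ∷ ps) = AllPairs-resp-⊆ τ ps
AllPairs-resp-⊆ (refl ∷ τ) (p ∷ ps) = All-resp-⊆ τ p ∷ AllPairs-resp-⊆ τ ps

∈⇒⊆-concat : {xs : List A} {xss : List (List A)} → xs ∈ xss → xs ⊆ concat xss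
∈⇒⊆-concat {xs = xs} (here refl) = ++⁺ʳ _ (⊆-refl {x = xs})
∈⇒⊆-concat {xss = ys ∷ _} (there xs∈) = ++⁺ˡ ys (∈⇒⊆-concat xs∈)

Pointwise-∈ʳ : {B : Set a} {R : A → B → Set ℓ} {xs : List A} {ys : List B} {y : B} →
               Pointwise R xs ys → y ∈ ys → Σ A λ x → x ∈ xs × R x y
Pointwise-∈ʳ (r ∷ _)  (here refl) = _ , here refl , r
Pointwise-∈ʳ (_ ∷ rs) (there y∈)  = Product.map₂ (Product.map₁ there) (Pointwise-∈ʳ rs y∈)

module _ {n : ℕ} where

  ++-nonemptyʳ : (x : Word n) {y : Word n} → Nonempty y → Nonempty (x ++ y)
  ++-nonemptyʳ x y≢[] = y≢[] ∘ ++-conicalʳ x _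

  length-<-++ : (x y : Word n) → Nonempty x → length y < length (x ++ y)
  length-<-++ []      y x≢[] = ⊥-elim (x≢[] refl)
  length-<-++ (_ ∷ x) y _    = s≤s (subst (length y ≤_) (sym (length-++ x)) (m≤n+m (length y) (length x)))

  prefix-++ : {x y : Word n} (z : Word n) → Prefix x y → Prefix x (y ++ z)
  prefix-++ {x} z (s , refl) = s ++ z , ++-assoc x s z

  prefix-trans : {x y z : Word n} → x ≥ₚ y → y ≥ₚ z → x ≥ₚ z
  prefix-trans {z = z} (s , refl) (s′ , refl) = s′ ++ s , ++-assoc z s′ s

  prefix-of-equal-++ : (xs : Word n) {ys : Word n} (us : Word n) {vs : Word n} →
                       xs ++ ys ≡ us ++ vs → length xs ≤ length us → Prefix xs us
  prefix-of-equal-++ []       us       _  _         = us , refl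
  prefix-of-equal-++ (x ∷ xs) (u ∷ us) eq (s≤s |xs|≤|us|) with ∷-injective eq
  ... | refl , eq′ = Product.map₂ (cong (x ∷_)) (prefix-of-equal-++ xs us eq′ |xs|≤|us|)

  power-+ : (t : Word n) (k l : ℕ) → power t k ++ power t l ≡ power t (k + l)
  power-+ t zero    l = refl
  power-+ t (suc k) l = trans (++-assoc t (power t k) (power t l)) (cong (t ++_) (power-+ t k l))

  commuting⇒powers : {x y : Word n} → Acc _<_ (length (x ++ y)) → x ++ y ≡ y ++ x →
                     Σ (Word n) λ t → Σ ℕ λ k → Σ ℕ λ l → x ≡ power t k × y ≡ power t l
  commuting⇒powers {[]} {y} _ _ = y , 0 , 1 , refl , sym (++-identityʳ y)
  commuting⇒powers {x} {[]} _ _ = x , 1 , 0 , sym (++-identityʳ x) , refl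
  commuting⇒powers {x@(_ ∷ _)} {y@(_ ∷ _)} (acc rs) xy≡yx with ≤-total (length x) (length y)
  ... | inj₁ |x|≤|y| with prefix-of-equal-++ x y xy≡yx |x|≤|y|
  ...   | e , refl with commuting⇒powers {x} {e} (rs (length-<-++ x (x ++ e) (λ ())))
                          (++-cancelˡ x _ _ (trans xy≡yx (++-assoc x e x)))
  ...     | t , k , l , x≡tᵏ , e≡tˡ = t , k , k + l , x≡tᵏ , trans (cong₂ _++_ x≡tᵏ e≡tˡ) (power-+ t k l)
  commuting⇒powers {x@(_ ∷ _)} {y@(_ ∷ _)} (acc rs) xy≡yx | inj₂ |y|≤|x|
    with prefix-of-equal-++ y x (sym xy≡yx) |y|≤|x|
  ... | e , refl with commuting⇒powers {y} {e}
                        (rs (subst (length (y ++ e) <_) (length-++-comm y (y ++ e)) (length-<-++ y (y ++ e) (λ ()))))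
                        (++-cancelˡ y _ _ (trans (sym xy≡yx) (++-assoc y e y)))
  ...   | t , k , l , y≡tᵏ , e≡tˡ = t , k + l , k , trans (cong₂ _++_ y≡tᵏ e≡tˡ) (power-+ t k l) , y≡tᵏ

  commuting⇒¬primitive : {x y : Word n} → Nonempty x → Nonempty y → x ++ y ≡ y ++ x → ¬ Primitive (x ++ y)
  commuting⇒¬primitive {x} {y} x≢[] y≢[] xy≡yx prim
    with commuting⇒powers {x} {y} (<-wellFounded _) xy≡yx
  ... | t , zero  , _     , refl , _    = x≢[] refl
  ... | t , _     , zero  , _    , refl = y≢[] refl
  ... | t , suc k , suc l , refl , refl = prim t (suc k + suc l) (+-mono-≤ (s≤s z≤n) (s≤s z≤n)) (power-+ t (suc k) (suc l))

  module _ {R : Fin n → Fin n → Set} where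

    Lex-<-++ˡ : (r : Word n) {xs ys : Word n} → Lex-< _≡_ R xs ys → Lex-< _≡_ R (r ++ xs) (r ++ ys)
    Lex-<-++ˡ []      xs<ys = xs<ys
    Lex-<-++ˡ (_ ∷ r) xs<ys = next refl (Lex-<-++ˡ r xs<ys)

    Lex⇒Lex-< : {x y : Word n} → Lex R x y → Lex-< _≡_ R x y
    Lex⇒Lex-<     (inj₁ ([] , s≢[] , _)) = ⊥-elim (s≢[] refl)
    Lex⇒Lex-< {x} (inj₁ (b ∷ s , _ , refl)) =
      subst (λ u → Lex-< _≡_ R u (x ++ b ∷ s)) (++-identityʳ x) (Lex-<-++ˡ x halt)
    Lex⇒Lex-< (inj₂ (r , _ , _ , _ , _ , refl , refl , a<b)) = Lex-<-++ˡ r (this a<b)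

    Lex-<-++⁻ : (us vs : Word n) {xs ys : Word n} → length us ≡ length vs →
                Lex-< _≡_ R (us ++ xs) (vs ++ ys) → Lex-< _≡_ R us vs ⊎ (us ≡ vs × Lex-< _≡_ R xs ys)
    Lex-<-++⁻ []       []        _  xs<ys        = inj₂ (refl , xs<ys)
    Lex-<-++⁻ (u ∷ us) (v ∷ vs)  _  (this u<v)   = inj₁ (this u<v)
    Lex-<-++⁻ (u ∷ us) (.u ∷ vs) eq (next refl l) =
      Sum.map (next refl) (Product.map₁ (cong (u ∷_))) (Lex-<-++⁻ us vs (suc-injective eq) l)

    conjugate-minimal⇒unbordered : Asymmetric R → {x : Word n} → Primitive x →
      ((u v : Word n) → x ≡ u ++ v → v ++ u ≢ x → Lex R x (v ++ u)) → ¬ Bordered x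
    conjugate-minimal⇒unbordered R-asym {x} prim minimal (z , z≢[] , (u , u≢[] , x≡zu) , (v , x≡vz))
      with ≡-dec Fin._≟_ u v
    ... | yes refl = commuting⇒¬primitive z≢[] u≢[] (trans (sym x≡zu) x≡vz) (subst Primitive x≡zu prim)
    ... | no u≢v with Lex-<-++⁻ z z refl (subst (λ w → Lex-< _≡_ R w (z ++ v)) x≡zu (Lex⇒Lex-< zv-greater))
                    | Lex-<-++⁻ v u |v|≡|u| (subst (λ w → Lex-< _≡_ R w (u ++ z)) x≡vz (Lex⇒Lex-< uz-greater))
      where
      zv-greater : Lex R x (z ++ v)
      zv-greater = minimal v z x≡vz (λ zv≡x → u≢v (++-cancelˡ z u v (trans (sym x≡zu) (sym zv≡x))))
      uz-greater : Lex R x (u ++ z)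
      uz-greater = minimal z u x≡zu (λ uz≡x → u≢v (++-cancelʳ z u v (trans uz≡x x≡vz)))
      open ≡-Reasoning
      |v|≡|u| : length v ≡ length u
      |v|≡|u| = +-cancelˡ-≡ (length z) _ _ (begin
        length z + length v  ≡⟨ length-++ z ⟨
        length (z ++ v)      ≡⟨ length-++-comm z v ⟩
        length (v ++ z)      ≡⟨ cong length (trans (sym x≡vz) x≡zu) ⟩
        length (z ++ u)      ≡⟨ length-++ z ⟩
        length z + length u  ∎)
    ... | inj₁ z<z       | _              = <-asymmetric sym (resp₂ R) R-asym z<z z<z
    ... | inj₂ (_ , u<v) | inj₁ v<u       = <-asymmetric sym (resp₂ R) R-asym u<v v<u
    ... | inj₂ _         | inj₂ (v≡u , _) = u≢v (sym v≡u)

  AntiLyndon⇒Unbordered : {x : Word n} → AntiLyndon x → Unbordered x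
  AntiLyndon⇒Unbordered (x≢[] , prim , minimal) =
    x≢[] , conjugate-minimal⇒unbordered Fin.<-asym prim minimal

  prefix⇒≼ᵢₙ : {x y : Word n} → x ≥ₚ y → y ≼ᵢₙ x
  prefix⇒≼ᵢₙ {y = y} ([] , x≡y[]) = inj₂ (sym (trans x≡y[] (++-identityʳ y)))
  prefix⇒≼ᵢₙ (c ∷ s , x≡ycs)     = inj₁ (inj₁ (c ∷ s , (λ ()) , x≡ycs))

  IsCFLin-prefixChain : {ℓs : List (Word n)} → All AntiLyndon ℓs → Linked _≥ₚ_ ℓs → IsCFLin (concat ℓs) ℓs
  IsCFLin-prefixChain anti chain = anti , refl , Linked.map prefix⇒≼ᵢₙ chain

  prefix⇒border : {y z : Word n} → Nonempty z → Prefix z y → Border z (y ++ z)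
  prefix⇒border {z = z} z≢[] (s , refl) = (s ++ z , ++-nonemptyʳ s z≢[] , ++-assoc z s z) , (z ++ s , refl)

  IsNB-++-prefixes : {x : Word n} {K : List (Word n)} (zs : List (Word n)) → IsNB x K →
                     All (λ z → Unbordered z × Prefix z x) zs → IsNB (x ++ concat zs) (K ++ zs)
  IsNB-++-prefixes {x} {K} [] nb [] = subst₂ IsNB (sym (++-identityʳ x)) (sym (++-identityʳ K)) nb
  IsNB-++-prefixes {x} {K} (z ∷ zs) nb ((z-unb@(z≢[] , _) , z≤x) ∷ rest) =
    subst₂ IsNB (++-assoc x z (concat zs)) (++-assoc K [ z ] zs)
      (IsNB-++-prefixes zs (nb-step z≢[] (prefix⇒border z≢[] z≤x) z-unb refl nb)
                           (All.map (Product.map₂ (prefix-++ z)) rest))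

  grouping-block : {L ms : List (Word n)} {m : Word n} → IsGroupingOfCFL L ms → m ∈ ms →
                   Σ (List (Word n)) λ b → b ≢ [] × b ⊆ L × AllPairs _≥ₚ_ b × m ≡ concat b
  grouping-block {L} (pmcs , (concat≡L , chains , _) , gs , groupings , refl) m∈
    with ∈-concat⁻′ gs m∈
  ... | g , m∈g , g∈gs with Pointwise-∈ʳ groupings g∈gs
  ... | P , P∈pmcs , (blocks , nonempty , concat≡P , refl , _) with ∈-map⁻ concat m∈g
  ... | b , b∈blocks , refl =
    b , All.lookup nonempty b∈blocks , ⊆-trans b⊆P P⊆L , AllPairs-resp-⊆ b⊆P P-chain , refl
    where
    b⊆P : b ⊆ P
    b⊆P = subst (b ⊆_) concat≡P (∈⇒⊆-concat b∈blocks)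
    P⊆L : P ⊆ L
    P⊆L = subst (P ⊆_) concat≡L (∈⇒⊆-concat P∈pmcs)
    P-chain : AllPairs _≥ₚ_ P
    P-chain = Linked⇒AllPairs prefix-trans (proj₂ (All.lookup chains P∈pmcs))

proposition8p9 : (n : ℕ) (w : Word n) → Nonempty w →
    (L : List (Word n)) → IsCFLin w L →
    (ms : List (Word n)) → IsGroupingOfCFL L ms →
    (m : Word n) → m ∈ ms →
    Σ (List (Word n)) λ K → IsCFLin m K × IsNB m K
proposition8p9 n w _ L (anti-Lyndon , _) ms grouping m m∈ms with grouping-block grouping m∈ms
... | [] , []≢[] , _ = ⊥-elim ([]≢[] refl)
... | h ∷ ts , _ , b⊆L , chain@(h≥ts ∷ _) , refl =
  h ∷ ts , IsCFLin-prefixChain b-anti (AllPairs⇒Linked chain) ,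
  IsNB-++-prefixes ts (nb-unb h-unb) (All.zip (ts-unb , h≥ts))
  where
  b-anti : All AntiLyndon (h ∷ ts)
  b-anti = All-resp-⊆ b⊆L anti-Lyndon
  h-unb : Unbordered h
  h-unb = AntiLyndon⇒Unbordered (All.head b-anti)
  ts-unb : All Unbordered ts
  ts-unb = All.map AntiLyndon⇒Unbordered (All.tail b-anti)
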